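{- Let $s(x)=\sum_{n\ge 0}|\operatorname{Av}_n(4123,4132,4213)|\,x^n$, where $\operatorname{Av}_n(4123,4132,4213)$ is the set of permutations of length $n$ avoiding each of $4123$, $4132$, $4213$ (so the constant term is $1$). Then \[ 1+(x-1)s(x)-x\,s(x)^2+x\,s(x)^3=0. \]
   Context: A permutation $\pi$ contains $\sigma$ if $\pi$ has a subsequence order isomorphic to $\sigma$; otherwise it avoids $\sigma$. -}

module Defs where

open import Data.Nat using (ℕ; zero; suc; _∸_)
open import Data.Fin using (Fin; _<_) renaming (zero to fz; suc to fs)
open import Data.Vec using (Vec; lookup; []; _∷_)
open import Data.Integer using (ℤ; +_; _+_; _*_; -_)
open import Data.List using (List; map; foldr; upTo)
open import Data.Product using (Σ; _×_)
open import Relation.Binary.PropositionalEquality using (_≡_)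
open import Function.Bundles using (_⇔_)
open import Relation.Nullary using (¬_)

-- A permutation of length n: a vector of n entries in Fin n with distinct entries
-- (one-line notation, 0-based values).
IsPerm : ∀ {n} → Vec (Fin n) n → Set
IsPerm {n} v = ∀ (i j : Fin n) → lookup v i ≡ lookup v j → i ≡ j

Contains : ∀ {n k} → Vec (Fin n) n → Vec (Fin k) k → Set
Contains {n} {k} π σ =
  Σ (Fin k → Fin n) λ f →
    (∀ (a b : Fin k) → a < b → f a < f b) ×
    (∀ (a b : Fin k) → (lookup σ a < lookup σ b) ⇔ (lookup π (f a) < lookup π (f b)))

Avoids : ∀ {n k} → Vec (Fin n) n → Vec (Fin k) k → Set
Avoids π σ = ¬ Contains π σ

p4123 p4132 p4213 : Vec (Fin 4) 4
p4123 = fs (fs (fs fz)) ∷ fz ∷ fs fz ∷ fs (fs fz) ∷ []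
p4132 = fs (fs (fs fz)) ∷ fz ∷ fs (fs fz) ∷ fs fz ∷ []
p4213 = fs (fs (fs fz)) ∷ fs fz ∷ fz ∷ fs (fs fz) ∷ []

-- The proof fields are irrelevant, so elements are determined by their vector
-- (this makes "Av n ↔ Fin m" express exactly |Av_n| = m).
record Av (n : ℕ) : Set where
  constructor mkAv
  field
    perm     : Vec (Fin n) n
    .isPerm  : IsPerm perm
    .av4123  : Avoids perm p4123
    .av4132  : Avoids perm p4132
    .av4213  : Avoids perm p4213

Series : Set
Series = ℕ → ℤ

_⊕_ : Series → Series → Series
(f ⊕ g) n = f n + g n

neg : Series → Series
neg f n = - f n

_⊗_ : Series → Series → Series
(f ⊗ g) n = foldr _+_ (+ 0) (map (λ i → f i * g (n ∸ i)) (upTo (suc n)))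

one : Series
one zero    = + 1
one (suc _) = + 0

X : Series
X zero          = + 0
X (suc zero)    = + 1
X (suc (suc _)) = + 0

lhs : Series → Series
lhs s = one ⊕ (((X ⊕ neg one) ⊗ s) ⊕ (neg (X ⊗ (s ⊗ s)) ⊕ (X ⊗ (s ⊗ (s ⊗ s)))))

-- Avoiders are built by repeatedly prepending a new first entry K (the old entries ≥ K move up by
-- one). This creates an occurrence of 4123, 4132 or 4213 exactly when some entries j < l < m of the
-- old permutation satisfy w j < w m < K and w l < K. The admissible K therefore form an initial
-- segment 0, …, |L|, and the list L of bits recording which values below |L| are left-to-right
-- minima determines the labels of all children: true ∷ L for K = |L|, and, for K = |r| with y ∷ r a
-- suffix of L, false ∷ true ∷ r or true ∷ r according as y is true or false. So |Av_n| = count n [],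
-- the number of walks of length n from [] in this generating tree.
--
-- Let s be the counting series, β = 1 − s + s², and Φ [] = s, Φ (true ∷ r) = β Φ r,
-- Φ (false ∷ r) = s Φ r. At each cons a ring identity shows that Φ L − 1 − x (sum of Φ over the
-- children of L) stays a multiple of the kernel s − 1 − x β s = −(1 + (x − 1) s − x s² + x s³).
-- If the kernel vanishes up to degree n, comparing coefficients gives count n L = [xⁿ] Φ L for all L;
-- in particular [xⁿ⁺¹] s = [xⁿ] β s, so the kernel vanishes in degree n + 1 as well.

module Submission where

open import Defs
open import Algebra.Bundles using (CommutativeRing)
open import Algebra.Solver.Ring.AlmostCommutativeRing using (fromCommutativeRing; _-Raw-AlmostCommutative⟶_)
open import Data.Bool using (Bool; true; false)
open import Data.Empty using (⊥-elim)
import Data.Empty.Irrelevant as Irrelevant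
open import Data.Fin using (Fin; toℕ; fromℕ<; opposite; punchIn; punchOut; inject₁; #_)
  renaming (zero to fzero; suc to fsuc; _<_ to _<ᶠ_)
open import Data.Fin.Permutation using (↔⇒≡)
import Data.Fin.Properties as Fin
open import Data.Integer using (ℤ; +_; _+_; _*_; -_; +-*-rawRing)
import Data.Integer.Properties as ℤ
open import Data.Integer.Tactic.RingSolver using (solve-∀)
open import Data.List using (List; []; _∷_; length)
import Data.List as List
open import Data.Maybe using (Maybe; just; nothing)
open import Data.Nat using (ℕ; zero; suc; _∸_; _<_; _≤_; z≤n; s≤s)
import Data.Nat as ℕ
import Data.Nat.Properties as ℕ
open import Data.Product using (Σ; ∃; _×_; _,_; proj₁; proj₂)
open import Data.Sum using (_⊎_; inj₁; inj₂)
import Data.Sum as Sum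
open import Data.Sum.Function.Propositional using (_⊎-↔_)
open import Data.Unit using (⊤; tt)
open import Data.Vec using (Vec; []; _∷_; lookup; map; tabulate)
import Data.Vec.Properties as Vecₚ
open import Function using (_∘_; _∘′_; id)
open import Function.Bundles using (_↔_; mk↔ₛ′; _⇔_; mk⇔; Equivalence)
open import Function.Properties.Inverse using (↔-trans; ↔-sym)
open import Relation.Binary.Definitions using (tri<; tri≈; tri>)
open import Relation.Binary.PropositionalEquality
import Relation.Binary.Reasoning.Setoid
open import Relation.Nullary using (¬_; yes; no)
open import Relation.Nullary.Decidable using (True; toWitness)

infix 4 _≈_
_≈_ : Series → Series → Set
f ≈ g = ∀ n → f n ≡ g n

≈-refl : ∀ {f} → f ≈ f
≈-refl _ = refl

≈-sym : ∀ {f g} → f ≈ g → g ≈ f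
≈-sym p n = sym (p n)

≈-trans : ∀ {f g h} → f ≈ g → g ≈ h → f ≈ h
≈-trans p q n = trans (p n) (q n)

zeros : Series
zeros _ = + 0

shift : Series → Series
shift f n = f (suc n)

-- f ⊗ g = f 0 · g + x · (shift f ⊗ g)
conv : Series → Series → Series
conv f g zero    = f 0 * g 0
conv f g (suc n) = f 0 * g (suc n) + conv (shift f) g n

sumUpTo : (ℕ → ℤ) → ℕ → ℤ
sumUpTo F zero    = + 0
sumUpTo F (suc m) = F 0 + sumUpTo (F ∘ suc) m

foldr-applyUpTo : ∀ m (h : ℕ → ℕ) (F : ℕ → ℤ) →
  List.foldr _+_ (+ 0) (List.map F (List.applyUpTo h m)) ≡ sumUpTo (F ∘ h) m
foldr-applyUpTo zero    h F = refl
foldr-applyUpTo (suc m) h F = cong (_+_ (F (h 0))) (foldr-applyUpTo m (h ∘ suc) F)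

conv-sumUpTo : ∀ n f g → conv f g n ≡ sumUpTo (λ i → f i * g (n ∸ i)) (suc n)
conv-sumUpTo zero    f g = sym (ℤ.+-identityʳ _)
conv-sumUpTo (suc n) f g = cong (_+_ (f 0 * g (suc n))) (conv-sumUpTo n (shift f) g)

⊗≗conv : ∀ f g n → (f ⊗ g) n ≡ conv f g n
⊗≗conv f g n = trans (foldr-applyUpTo (suc n) id (λ i → f i * g (n ∸ i))) (sym (conv-sumUpTo n f g))

conv-cong : ∀ {f f′ g g′} → f ≈ f′ → g ≈ g′ → conv f g ≈ conv f′ g′
conv-cong f≈ g≈ zero    = cong₂ _*_ (f≈ 0) (g≈ 0)
conv-cong f≈ g≈ (suc n) = cong₂ _+_ (cong₂ _*_ (f≈ 0) (g≈ (suc n))) (conv-cong (f≈ ∘ suc) g≈ n)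

conv-zeroˡ : ∀ g → conv zeros g ≈ zeros
conv-zeroˡ g zero    = ℤ.*-zeroˡ (g 0)
conv-zeroˡ g (suc n) = cong₂ _+_ (ℤ.*-zeroˡ (g (suc n))) (conv-zeroˡ g n)

conv-identityˡ : ∀ g → conv one g ≈ g
conv-identityˡ g zero    = ℤ.*-identityˡ (g 0)
conv-identityˡ g (suc n) =
  trans (cong₂ _+_ (ℤ.*-identityˡ (g (suc n))) (conv-zeroˡ g n)) (ℤ.+-identityʳ _)

conv-distribˡ : ∀ f g h → conv f (g ⊕ h) ≈ conv f g ⊕ conv f h
conv-distribˡ f g h zero    = ℤ.*-distribˡ-+ (f 0) (g 0) (h 0)
conv-distribˡ f g h (suc n) =
  trans (cong (_+_ (f 0 * (g (suc n) + h (suc n)))) (conv-distribˡ (shift f) g h n))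
    (interchange (f 0) (g (suc n)) (h (suc n)) (conv (shift f) g n) (conv (shift f) h n))
  where
  interchange : ∀ a b c d e → a * (b + c) + (d + e) ≡ (a * b + d) + (a * c + e)
  interchange = solve-∀

conv-distribʳ : ∀ f g h → conv (f ⊕ g) h ≈ conv f h ⊕ conv g h
conv-distribʳ f g h zero    = ℤ.*-distribʳ-+ (h 0) (f 0) (g 0)
conv-distribʳ f g h (suc n) =
  trans (cong (_+_ ((f 0 + g 0) * h (suc n))) (conv-distribʳ (shift f) (shift g) h n))
    (interchange (f 0) (g 0) (h (suc n)) (conv (shift f) h n) (conv (shift g) h n))
  where
  interchange : ∀ a b c d e → (a + b) * c + (d + e) ≡ (a * c + d) + (b * c + e)
  interchange = solve-∀

conv-scaleˡ : ∀ c f g → conv (λ i → c * f i) g ≈ (λ i → c * conv f g i)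
conv-scaleˡ c f g zero    = ℤ.*-assoc c (f 0) (g 0)
conv-scaleˡ c f g (suc n) =
  trans (cong (_+_ ((c * f 0) * g (suc n))) (conv-scaleˡ c (shift f) g n)) (factor c (f 0) (g (suc n)) (conv (shift f) g n))
  where
  factor : ∀ c a b d → (c * a) * b + c * d ≡ c * (a * b + d)
  factor = solve-∀

conv-assoc : ∀ f g h → conv (conv f g) h ≈ conv f (conv g h)
conv-assoc f g h zero    = ℤ.*-assoc (f 0) (g 0) (h 0)
conv-assoc f g h (suc n) =
  trans (cong (_+_ ((f 0 * g 0) * h (suc n)))
          (trans (conv-distribʳ (λ i → f 0 * g (suc i)) (conv (shift f) g) h n)
                 (cong₂ _+_ (conv-scaleˡ (f 0) (shift g) h n) (conv-assoc (shift f) g h n))))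
        (regroup (f 0) (g 0) (h (suc n)) (conv (shift g) h n) (conv (shift f) (conv g h) n))
  where
  regroup : ∀ a b c d e → (a * b) * c + (a * d + e) ≡ a * (b * c + d) + e
  regroup = solve-∀

conv-suc : ∀ f g n → conv f g (suc n) ≡ conv f (shift g) n + f (suc n) * g 0
conv-suc f g zero    = refl
conv-suc f g (suc n) =
  trans (cong (_+_ (f 0 * g (suc (suc n)))) (conv-suc (shift f) g n))
        (sym (ℤ.+-assoc (f 0 * g (suc (suc n))) (conv (shift f) (shift g) n) (f (suc (suc n)) * g 0)))

conv-comm : ∀ f g → conv f g ≈ conv g f
conv-comm f g zero    = ℤ.*-comm (f 0) (g 0)
conv-comm f g (suc n) = begin
  f 0 * g (suc n) + conv (shift f) g n  ≡⟨ cong (_+_ (f 0 * g (suc n))) (conv-comm (shift f) g n) ⟩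
  f 0 * g (suc n) + conv g (shift f) n  ≡⟨ ℤ.+-comm (f 0 * g (suc n)) _ ⟩
  conv g (shift f) n + f 0 * g (suc n)  ≡⟨ cong (_+_ (conv g (shift f) n)) (ℤ.*-comm (f 0) (g (suc n))) ⟩
  conv g (shift f) n + g (suc n) * f 0  ≡⟨ sym (conv-suc g f n) ⟩
  conv g f (suc n)                      ∎
  where open ≡-Reasoning

⊗-cong : ∀ {f f′ g g′} → f ≈ f′ → g ≈ g′ → f ⊗ g ≈ f′ ⊗ g′
⊗-cong {f} {f′} {g} {g′} f≈ g≈ n =
  trans (⊗≗conv f g n) (trans (conv-cong f≈ g≈ n) (sym (⊗≗conv f′ g′ n)))

⊗-comm : ∀ f g → f ⊗ g ≈ g ⊗ f
⊗-comm f g n = trans (⊗≗conv f g n) (trans (conv-comm f g n) (sym (⊗≗conv g f n)))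

⊗-assoc : ∀ f g h → (f ⊗ g) ⊗ h ≈ f ⊗ (g ⊗ h)
⊗-assoc f g h n = begin
  ((f ⊗ g) ⊗ h) n         ≡⟨ ⊗≗conv (f ⊗ g) h n ⟩
  conv (f ⊗ g) h n        ≡⟨ conv-cong (⊗≗conv f g) ≈-refl n ⟩
  conv (conv f g) h n     ≡⟨ conv-assoc f g h n ⟩
  conv f (conv g h) n     ≡⟨ conv-cong ≈-refl (≈-sym (⊗≗conv g h)) n ⟩
  conv f (g ⊗ h) n        ≡⟨ sym (⊗≗conv f (g ⊗ h) n) ⟩
  (f ⊗ (g ⊗ h)) n         ∎
  where open ≡-Reasoning

⊗-identityˡ : ∀ f → one ⊗ f ≈ f
⊗-identityˡ f n = trans (⊗≗conv one f n) (conv-identityˡ f n)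

⊗-identityʳ : ∀ f → f ⊗ one ≈ f
⊗-identityʳ f n = trans (⊗-comm f one n) (⊗-identityˡ f n)

⊗-distribˡ : ∀ f g h → f ⊗ (g ⊕ h) ≈ (f ⊗ g) ⊕ (f ⊗ h)
⊗-distribˡ f g h n = trans (⊗≗conv f (g ⊕ h) n)
  (trans (conv-distribˡ f g h n) (sym (cong₂ _+_ (⊗≗conv f g n) (⊗≗conv f h n))))

⊗-distribʳ : ∀ f g h → (g ⊕ h) ⊗ f ≈ (g ⊗ f) ⊕ (h ⊗ f)
⊗-distribʳ f g h n = trans (⊗≗conv (g ⊕ h) f n)
  (trans (conv-distribʳ g h f n) (sym (cong₂ _+_ (⊗≗conv g f n) (⊗≗conv h f n))))

seriesRing : CommutativeRing _ _
seriesRing = record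
  { Carrier = Series ; _≈_ = _≈_ ; _+_ = _⊕_ ; _*_ = _⊗_ ; -_ = neg ; 0# = zeros ; 1# = one
  ; isCommutativeRing = record
    { isRing = record
      { +-isAbelianGroup = record
        { isGroup = record
          { isMonoid = record
            { isSemigroup = record
              { isMagma = record
                { isEquivalence = record { refl = ≈-refl ; sym = ≈-sym ; trans = ≈-trans }
                ; ∙-cong = λ p q n → cong₂ _+_ (p n) (q n) }
              ; assoc = λ f g h n → ℤ.+-assoc (f n) (g n) (h n) }
            ; identity = (λ f n → ℤ.+-identityˡ (f n)) , (λ f n → ℤ.+-identityʳ (f n)) }
          ; inverse = (λ f n → ℤ.+-inverseˡ (f n)) , (λ f n → ℤ.+-inverseʳ (f n))
          ; ⁻¹-cong = λ p n → cong -_ (p n) }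
        ; comm = λ f g n → ℤ.+-comm (f n) (g n) }
      ; *-cong = ⊗-cong
      ; *-assoc = ⊗-assoc
      ; *-identity = ⊗-identityˡ , ⊗-identityʳ
      ; distrib = ⊗-distribˡ , ⊗-distribʳ }
    ; *-comm = ⊗-comm } }

embed : ℤ → Series
embed c n = c * one n

embed-morphism : +-*-rawRing -Raw-AlmostCommutative⟶ fromCommutativeRing seriesRing
embed-morphism = record
  { ⟦_⟧    = embed
  ; +-homo = λ a b n → ℤ.*-distribʳ-+ (one n) a b
  ; *-homo = λ a b n → trans (ℤ.*-assoc a b (one n))
                       (sym (trans (⊗≗conv (embed a) (embed b) n)
                            (trans (conv-scaleˡ a one (embed b) n) (cong (a *_) (conv-identityˡ (embed b) n)))))
  ; -‿homo = λ a n → sym (ℤ.neg-distribˡ-* a (one n))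
  ; 0-homo = λ n → ℤ.*-zeroˡ (one n)
  ; 1-homo = λ n → ℤ.*-identityˡ (one n)
  }

embed-≟ : ∀ a b → Maybe (embed a ≈ embed b)
embed-≟ a b with a ℤ.≟ b
... | yes refl = just (λ _ → refl)
... | no _     = nothing

open import Algebra.Solver.Ring +-*-rawRing (fromCommutativeRing seriesRing) embed-morphism embed-≟

module SeriesReasoning = Relation.Binary.Reasoning.Setoid (CommutativeRing.setoid seriesRing)

childAt : Bool → List Bool → List Bool
childAt true  r = false ∷ true ∷ r
childAt false r = true ∷ r

lowerChild : (L : List Bool) → Fin (length L) → List Bool
lowerChild (y ∷ r) fzero    = childAt y r
lowerChild (y ∷ r) (fsuc i) = lowerChild r i

child : (L : List Bool) → Fin (suc (length L)) → List Bool
child L fzero    = true ∷ L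
child L (fsuc i) = lowerChild L i

count : ℕ → List Bool → ℕ
countLower : ℕ → List Bool → ℕ
count zero    L = 1
count (suc n) L = count n (true ∷ L) ℕ.+ countLower n L
countLower n []      = 0
countLower n (y ∷ r) = count n (childAt y r) ℕ.+ countLower n r

Walk : ℕ → List Bool → Set
Walk zero    L = ⊤
Walk (suc n) L = Σ (Fin (suc (length L))) λ i → Walk n (child L i)

Σ-Fin-suc↔ : ∀ {m} (B : Fin (suc m) → Set) → Σ (Fin (suc m)) B ↔ (B fzero ⊎ Σ (Fin m) (B ∘ fsuc))
Σ-Fin-suc↔ B = mk↔ₛ′
  (λ { (fzero , b) → inj₁ b ; (fsuc i , b) → inj₂ (i , b) })
  (λ { (inj₁ b) → fzero , b ; (inj₂ (i , b)) → fsuc i , b })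
  (λ { (inj₁ b) → refl ; (inj₂ (i , b)) → refl })
  (λ { (fzero , b) → refl ; (fsuc i , b) → refl })

Σ-Fin-zero↔ : (B : Fin 0 → Set) → Σ (Fin 0) B ↔ Fin 0
Σ-Fin-zero↔ B = mk↔ₛ′ (λ { (() , _) }) (λ ()) (λ ()) (λ { (() , _) })

Walk↔count : ∀ n L → Walk n L ↔ Fin (count n L)
lowerWalks↔countLower : ∀ n L → Σ (Fin (length L)) (λ i → Walk n (lowerChild L i)) ↔ Fin (countLower n L)
Walk↔count zero    L = mk↔ₛ′ (λ _ → fzero) (λ _ → tt) (λ { fzero → refl ; (fsuc ()) }) (λ _ → refl)
Walk↔count (suc n) L = ↔-trans (Σ-Fin-suc↔ (Walk n ∘ child L))
  (↔-trans (Walk↔count n (true ∷ L) ⊎-↔ lowerWalks↔countLower n L)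
           (↔-sym (Fin.+↔⊎ {count n (true ∷ L)})))
lowerWalks↔countLower n []      = Σ-Fin-zero↔ _
lowerWalks↔countLower n (y ∷ r) = ↔-trans (Σ-Fin-suc↔ (Walk n ∘ lowerChild (y ∷ r)))
  (↔-trans (Walk↔count n (childAt y r) ⊎-↔ lowerWalks↔countLower n r)
           (↔-sym (Fin.+↔⊎ {count n (childAt y r)})))

end : ∀ n L → Walk n L → List Bool
end zero    L _       = L
end (suc n) L (i , w) = end n (child L i) w

Extension : ℕ → List Bool → Set
Extension n L = Σ (Walk n L) λ w → Fin (suc (length (end n L w)))

snoc : ∀ n L → Extension n L → Walk (suc n) L
snoc zero    L (tt , i)      = i , tt
snoc (suc n) L ((j , w) , i) = j , snoc n (child L j) (w , i)

unsnoc : ∀ n L → Walk (suc n) L → Extension n L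
unsnoc zero    L (i , tt) = tt , i
unsnoc (suc n) L (j , w)  with unsnoc n (child L j) w
... | w′ , i = (j , w′) , i

unsnoc-snoc : ∀ n L e → unsnoc n L (snoc n L e) ≡ e
unsnoc-snoc zero    L (tt , i)      = refl
unsnoc-snoc (suc n) L ((j , w) , i) rewrite unsnoc-snoc n (child L j) (w , i) = refl

snoc-unsnoc : ∀ n L w → snoc n L (unsnoc n L w) ≡ w
snoc-unsnoc zero    L (i , tt) = refl
snoc-unsnoc (suc n) L (j , w) with unsnoc n (child L j) w | snoc-unsnoc n (child L j) w
... | w′ , i | eq = cong (j ,_) eq

end-snoc : ∀ n L w i → end (suc n) L (snoc n L (w , i)) ≡ child (end n L w) i
end-snoc zero    L tt      i = refl
end-snoc (suc n) L (j , w) i = end-snoc n (child L j) w i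

X⊗-zero : ∀ f → (X ⊗ f) 0 ≡ + 0
X⊗-zero f = trans (⊗≗conv X f 0) (ℤ.*-zeroˡ (f 0))

X⊗-suc : ∀ f n → (X ⊗ f) (suc n) ≡ f n
X⊗-suc f n = begin
  (X ⊗ f) (suc n)                       ≡⟨ ⊗≗conv X f (suc n) ⟩
  + 0 * f (suc n) + conv (shift X) f n  ≡⟨ ℤ.+-identityˡ _ ⟩
  conv (shift X) f n                    ≡⟨ conv-cong shift-X≈one ≈-refl n ⟩
  conv one f n                          ≡⟨ conv-identityˡ f n ⟩
  f n                                   ∎
  where
  open ≡-Reasoning
  shift-X≈one : shift X ≈ one
  shift-X≈one zero    = refl
  shift-X≈one (suc n) = refl

VanishesUpTo : Series → ℕ → Set
VanishesUpTo f n = ∀ i → i ≤ n → f i ≡ + 0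

conv-vanishes : ∀ {f} g n → VanishesUpTo f n → conv f g n ≡ + 0
conv-vanishes {f} g zero    f≈0 = trans (cong (_* g 0) (f≈0 0 z≤n)) (ℤ.*-zeroˡ (g 0))
conv-vanishes {f} g (suc n) f≈0 = cong₂ _+_
  (trans (cong (_* g (suc n)) (f≈0 0 z≤n)) (ℤ.*-zeroˡ (g (suc n))))
  (conv-vanishes g n (λ i i≤n → f≈0 (suc i) (s≤s i≤n)))

⊗-vanishes : ∀ {f} g n → VanishesUpTo f n → (f ⊗ g) n ≡ + 0
⊗-vanishes {f} g n f≈0 = trans (⊗≗conv f g n) (conv-vanishes g n f≈0)

-- the constant 1 as the ring solver reads `con (+ 1)`; it agrees with `one` only pointwise
𝟙 : Series
𝟙 = embed (+ 1)

β : Series → Series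
β s = (𝟙 ⊕ neg s) ⊕ (s ⊗ s)

kernel : Series → Series
kernel s = (s ⊕ neg 𝟙) ⊕ neg (X ⊗ (β s ⊗ s))

lhs≈-kernel : ∀ s → lhs s ≈ neg (kernel s)
lhs≈-kernel s = ≈-trans lhs≈lhs𝟙 (solve 2 (λ s x →
    con (+ 1) :+ (((x :- con (+ 1)) :* s) :+ ((:- (x :* (s :* s))) :+ (x :* (s :* (s :* s)))))
    := :- ((s :- con (+ 1)) :- (x :* (((con (+ 1) :- s) :+ (s :* s)) :* s)))) ≈-refl s X)
  where
  one≈𝟙 : one ≈ 𝟙
  one≈𝟙 zero    = refl
  one≈𝟙 (suc n) = refl
  lhs≈lhs𝟙 : lhs s ≈ 𝟙 ⊕ (((X ⊕ neg 𝟙) ⊗ s) ⊕ (neg (X ⊗ (s ⊗ s)) ⊕ (X ⊗ (s ⊗ (s ⊗ s)))))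
  lhs≈lhs𝟙 n = cong₂ _+_ (one≈𝟙 n)
    (cong (_+ (neg (X ⊗ (s ⊗ s)) ⊕ (X ⊗ (s ⊗ (s ⊗ s)))) n)
          (⊗-cong {X ⊕ neg one} {X ⊕ neg 𝟙} {s} {s} (λ m → cong (λ u → X m + - u) (one≈𝟙 m)) ≈-refl n))

module Kernel (s : Series) where

  open CommutativeRing seriesRing using (+-congʳ)

  Φ : List Bool → Series
  Φ []          = s
  Φ (true ∷ r)  = β s ⊗ Φ r
  Φ (false ∷ r) = s ⊗ Φ r

  ΦLower : List Bool → Series
  ΦLower []      = zeros
  ΦLower (y ∷ r) = Φ (childAt y r) ⊕ ΦLower r

  expansion : List Bool → Series
  expansion L = 𝟙 ⊕ (X ⊗ (Φ (true ∷ L) ⊕ ΦLower L))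

  defect : List Bool → Series
  defect L = Φ L ⊕ neg (expansion L)

  defect-nil : defect [] ≈ kernel s
  defect-nil = solve 2 (λ s x → let b = (con (+ 1) :- s) :+ (s :* s) in
    s :- (con (+ 1) :+ (x :* ((b :* s) :+ con (+ 0)))) := (s :- con (+ 1)) :- (x :* (b :* s))) ≈-refl s X

  defect-true : ∀ r → defect (true ∷ r) ≈ defect r ⊕ (kernel s ⊗ (s ⊗ Φ r))
  defect-true r = solve 4 (λ s x P R →
    let b = (con (+ 1) :- s) :+ (s :* s); k = (s :- con (+ 1)) :- (x :* (b :* s)) in
    (b :* P) :- (con (+ 1) :+ (x :* ((b :* (b :* P)) :+ ((s :* (b :* P)) :+ R))))
    := (P :- (con (+ 1) :+ (x :* ((b :* P) :+ R)))) :+ (k :* (s :* P))) ≈-refl s X (Φ r) (ΦLower r)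

  defect-false : ∀ r → defect (false ∷ r) ≈ defect r ⊕ (kernel s ⊗ Φ r)
  defect-false r = solve 4 (λ s x P R →
    let b = (con (+ 1) :- s) :+ (s :* s); k = (s :- con (+ 1)) :- (x :* (b :* s)) in
    (s :* P) :- (con (+ 1) :+ (x :* ((b :* (s :* P)) :+ ((b :* P) :+ R))))
    := (P :- (con (+ 1) :+ (x :* ((b :* P) :+ R)))) :+ (k :* P)) ≈-refl s X (Φ r) (ΦLower r)

  defect-multiple : ∀ L → ∃ λ c → defect L ≈ kernel s ⊗ c
  defect-multiple [] = one , ≈-trans defect-nil (≈-sym (⊗-identityʳ (kernel s)))
  defect-multiple (true ∷ r) with defect-multiple r
  ... | c , d≈kc = c ⊕ (s ⊗ Φ r) , (begin
    defect (true ∷ r)                          ≈⟨ defect-true r ⟩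
    defect r ⊕ (kernel s ⊗ (s ⊗ Φ r))          ≈⟨ +-congʳ d≈kc ⟩
    (kernel s ⊗ c) ⊕ (kernel s ⊗ (s ⊗ Φ r))    ≈⟨ ≈-sym (⊗-distribˡ (kernel s) c (s ⊗ Φ r)) ⟩
    kernel s ⊗ (c ⊕ (s ⊗ Φ r))                 ∎)
    where open SeriesReasoning
  defect-multiple (false ∷ r) with defect-multiple r
  ... | c , d≈kc = c ⊕ Φ r , (begin
    defect (false ∷ r)                ≈⟨ defect-false r ⟩
    defect r ⊕ (kernel s ⊗ Φ r)       ≈⟨ +-congʳ d≈kc ⟩
    (kernel s ⊗ c) ⊕ (kernel s ⊗ Φ r) ≈⟨ ≈-sym (⊗-distribˡ (kernel s) c (Φ r)) ⟩
    kernel s ⊗ (c ⊕ Φ r)              ∎)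
    where open SeriesReasoning

  Φ≡expansion : ∀ n → VanishesUpTo (kernel s) n → ∀ L → Φ L n ≡ expansion L n
  Φ≡expansion n k≈0 L with defect-multiple L
  ... | c , d≈kc = begin
    Φ L n                          ≡⟨ solve 2 (λ P E → P := E :+ (P :- E)) ≈-refl (Φ L) (expansion L) n ⟩
    expansion L n + defect L n     ≡⟨ cong (_+_ (expansion L n)) (trans (d≈kc n) (⊗-vanishes c n k≈0)) ⟩
    expansion L n + + 0            ≡⟨ ℤ.+-identityʳ _ ⟩
    expansion L n                  ∎
    where open ≡-Reasoning

  count≡Φ : ∀ n → VanishesUpTo (kernel s) n → ∀ L → + count n L ≡ Φ L n
  countLower≡ΦLower : ∀ n → VanishesUpTo (kernel s) n → ∀ L → + countLower n L ≡ ΦLower L n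
  count≡Φ zero k≈0 L =
    sym (trans (Φ≡expansion 0 k≈0 L) (cong (_+_ (+ 1)) (X⊗-zero (Φ (true ∷ L) ⊕ ΦLower L))))
  count≡Φ (suc n) k≈0 L = begin
    + count (suc n) L                          ≡⟨ ℤ.pos-+ (count n (true ∷ L)) (countLower n L) ⟩
    + count n (true ∷ L) + + countLower n L    ≡⟨ cong₂ _+_ (count≡Φ n k≈0′ (true ∷ L))
                                                             (countLower≡ΦLower n k≈0′ L) ⟩
    Φ (true ∷ L) n + ΦLower L n                ≡⟨ X⊗-suc (Φ (true ∷ L) ⊕ ΦLower L) n ⟨
    (X ⊗ (Φ (true ∷ L) ⊕ ΦLower L)) (suc n)    ≡⟨ ℤ.+-identityˡ _ ⟨
    expansion L (suc n)                        ≡⟨ Φ≡expansion (suc n) k≈0 L ⟨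
    Φ L (suc n)                                ∎
    where
    open ≡-Reasoning
    k≈0′ : VanishesUpTo (kernel s) n
    k≈0′ i i≤n = k≈0 i (ℕ.m≤n⇒m≤1+n i≤n)
  countLower≡ΦLower n k≈0 []      = refl
  countLower≡ΦLower n k≈0 (y ∷ r) = trans (ℤ.pos-+ (count n (childAt y r)) (countLower n r))
    (cong₂ _+_ (count≡Φ n k≈0 (childAt y r)) (countLower≡ΦLower n k≈0 r))

  kernel-vanishes : (∀ n → s n ≡ + count n []) → ∀ n → VanishesUpTo (kernel s) n
  kernel-vanishes s≡count zero .zero z≤n =
    cong₂ (λ a b → (a + - + 1) + - b) (s≡count 0) (X⊗-zero (β s ⊗ s))
  kernel-vanishes s≡count (suc n) i i≤1+n with ℕ.m≤n⇒m<n∨m≡n i≤1+n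
  ... | inj₁ i<1+n = kernel-vanishes s≡count n i (ℕ.≤-pred i<1+n)
  ... | inj₂ refl  = begin
    (s (suc n) + - + 0) + - (X ⊗ (β s ⊗ s)) (suc n)
      ≡⟨ cong₂ (λ a b → (a + - + 0) + - b) s≡βs (X⊗-suc (β s ⊗ s) n) ⟩
    ((β s ⊗ s) n + + 0) + - (β s ⊗ s) n
      ≡⟨ cong (_+ - (β s ⊗ s) n) (ℤ.+-identityʳ ((β s ⊗ s) n)) ⟩
    (β s ⊗ s) n + - (β s ⊗ s) n
      ≡⟨ ℤ.+-inverseʳ ((β s ⊗ s) n) ⟩
    + 0
      ∎
    where
    open ≡-Reasoning
    s≡βs : s (suc n) ≡ (β s ⊗ s) n
    s≡βs = begin
      s (suc n)                       ≡⟨ s≡count (suc n) ⟩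
      + (count n (true ∷ []) ℕ.+ 0)   ≡⟨ cong +_ (ℕ.+-identityʳ _) ⟩
      + count n (true ∷ [])           ≡⟨ count≡Φ n (kernel-vanishes s≡count n) (true ∷ []) ⟩
      (β s ⊗ s) n                     ∎

punchInℕ : ℕ → ℕ → ℕ
punchInℕ zero    x       = suc x
punchInℕ (suc K) zero    = zero
punchInℕ (suc K) (suc x) = suc (punchInℕ K x)

punchInℕ-< : ∀ K x → x < K → punchInℕ K x ≡ x
punchInℕ-< (suc K) zero    _         = refl
punchInℕ-< (suc K) (suc x) (s≤s x<K) = cong suc (punchInℕ-< K x x<K)

punchInℕ-≥ : ∀ K x → K ≤ x → punchInℕ K x ≡ suc x
punchInℕ-≥ zero    x       _         = refl
punchInℕ-≥ (suc K) (suc x) (s≤s K≤x) = cong suc (punchInℕ-≥ K x K≤x)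

punchInℕ-self : ∀ K → punchInℕ K K ≡ suc K
punchInℕ-self K = punchInℕ-≥ K K ℕ.≤-refl

punchInℕ-mono : ∀ K {x y} → x < y → punchInℕ K x < punchInℕ K y
punchInℕ-mono zero    x<y             = s≤s x<y
punchInℕ-mono (suc K) {zero} {suc y} _ = s≤s z≤n
punchInℕ-mono (suc K) {suc x} {suc y} (s≤s x<y) = s≤s (punchInℕ-mono K x<y)

punchInℕ-cancel : ∀ K {x y} → punchInℕ K x < punchInℕ K y → x < y
punchInℕ-cancel zero    (s≤s x<y) = x<y
punchInℕ-cancel (suc K) {zero}  {suc y} _         = s≤s z≤n
punchInℕ-cancel (suc K) {suc x} {zero}  ()
punchInℕ-cancel (suc K) {suc x} {suc y} (s≤s p)   = s≤s (punchInℕ-cancel K p)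
punchInℕ-cancel (suc K) {zero}  {zero}  ()

punchInℕ-injective : ∀ K {x y} → punchInℕ K x ≡ punchInℕ K y → x ≡ y
punchInℕ-injective K {x} {y} eq with ℕ.<-cmp x y
... | tri< x<y _ _ = ⊥-elim (ℕ.<-irrefl eq (punchInℕ-mono K x<y))
... | tri≈ _ x≡y _ = x≡y
... | tri> _ _ y<x = ⊥-elim (ℕ.<-irrefl (sym eq) (punchInℕ-mono K y<x))

punchInℕ-inflationary : ∀ K x → x ≤ punchInℕ K x
punchInℕ-inflationary zero    x       = ℕ.n≤1+n x
punchInℕ-inflationary (suc K) zero    = z≤n
punchInℕ-inflationary (suc K) (suc x) = s≤s (punchInℕ-inflationary K x)

punchInℕ-<-reflect : ∀ K x → punchInℕ K x < K → x < K
punchInℕ-<-reflect K x p with x ℕ.<? K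
... | yes x<K = x<K
... | no  x≮K = ⊥-elim (ℕ.<-asym p (subst (K <_) (sym (punchInℕ-≥ K x K≤x)) (s≤s K≤x)))
  where
  K≤x : K ≤ x
  K≤x = ℕ.≮⇒≥ x≮K

punchInℕ-<-preserve : ∀ K x → x < K → punchInℕ K x < K
punchInℕ-<-preserve K x x<K = subst (_< K) (sym (punchInℕ-< K x x<K)) x<K

punchInℕ-<-suc : ∀ K x t → K ≤ t → punchInℕ K x < suc t → x < t
punchInℕ-<-suc K x t K≤t p with x ℕ.<? K
... | yes x<K = ℕ.<-≤-trans x<K K≤t
... | no  x≮K = ℕ.≤-pred (subst (_< suc t) (punchInℕ-≥ K x (ℕ.≮⇒≥ x≮K)) p)

Word : ℕ → Set
Word n = Fin n → ℕ

module _ {n : ℕ} where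

  Injective : Word n → Set
  Injective w = ∀ p q → w p ≡ w q → p ≡ q

  Onto : Word n → Set
  Onto w = ∀ x → x < n → Σ (Fin n) λ p → w p ≡ x

  -- an occurrence of 4123, 4132 or 4213: an entry, then three smaller ones of which the first is below the last
  Forbidden : Word n → Set
  Forbidden w = Σ (Fin n) λ i → Σ (Fin n) λ j → Σ (Fin n) λ l → Σ (Fin n) λ m →
    (i <ᶠ j) × (j <ᶠ l) × (l <ᶠ m) × (w j < w m) × (w m < w i) × (w l < w i)

  -- the last three entries of an occurrence that a new first entry t would complete
  ForbiddenBelow : Word n → ℕ → Set
  ForbiddenBelow w t = Σ (Fin n) λ j → Σ (Fin n) λ l → Σ (Fin n) λ m →
    (j <ᶠ l) × (l <ᶠ m) × (w j < w m) × (w m < t) × (w l < t)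

  LeftToRightMin : Word n → ℕ → Set
  LeftToRightMin w x = Σ (Fin n) λ p → (w p ≡ x) × (∀ q → q <ᶠ p → x < w q)

  forbiddenBelow-mono : ∀ (w : Word n) {t t′} → t ≤ t′ → ForbiddenBelow w t → ForbiddenBelow w t′
  forbiddenBelow-mono w t≤t′ (j , l , m , j<l , l<m , wj<wm , wm<t , wl<t) =
    j , l , m , j<l , l<m , wj<wm , ℕ.<-≤-trans wm<t t≤t′ , ℕ.<-≤-trans wl<t t≤t′

prepend : ∀ {n} → ℕ → Word n → Word (suc n)
prepend K w fzero    = K
prepend K w (fsuc p) = punchInℕ K (w p)

module _ {n} (K : ℕ) (w : Word n) where

  forbidden-prepend⁻ : Forbidden (prepend K w) → Forbidden w ⊎ ForbiddenBelow w K
  forbidden-prepend⁻ (fzero , fsuc j , fsuc l , fsuc m , _ , s≤s j<l , s≤s l<m , wj<wm , wm<K , wl<K) =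
    inj₂ (j , l , m , j<l , l<m ,
          punchInℕ-cancel K wj<wm , punchInℕ-<-reflect K _ wm<K , punchInℕ-<-reflect K _ wl<K)
  forbidden-prepend⁻ (fsuc i , fsuc j , fsuc l , fsuc m , s≤s i<j , s≤s j<l , s≤s l<m , wj<wm , wm<wi , wl<wi) =
    inj₁ (i , j , l , m , i<j , j<l , l<m ,
          punchInℕ-cancel K wj<wm , punchInℕ-cancel K wm<wi , punchInℕ-cancel K wl<wi)

  forbidden-prepend⁺ : Forbidden w ⊎ ForbiddenBelow w K → Forbidden (prepend K w)
  forbidden-prepend⁺ (inj₁ (i , j , l , m , i<j , j<l , l<m , wj<wm , wm<wi , wl<wi)) =
    fsuc i , fsuc j , fsuc l , fsuc m , s≤s i<j , s≤s j<l , s≤s l<m ,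
    punchInℕ-mono K wj<wm , punchInℕ-mono K wm<wi , punchInℕ-mono K wl<wi
  forbidden-prepend⁺ (inj₂ (j , l , m , j<l , l<m , wj<wm , wm<K , wl<K)) =
    fzero , fsuc j , fsuc l , fsuc m , s≤s z≤n , s≤s j<l , s≤s l<m ,
    punchInℕ-mono K wj<wm , punchInℕ-<-preserve K _ wm<K , punchInℕ-<-preserve K _ wl<K

  prepend-old-K : ∀ {p} → w p ≡ K → prepend K w (fsuc p) ≡ suc K
  prepend-old-K wp≡K = trans (cong (punchInℕ K) wp≡K) (punchInℕ-self K)

  prepend-old-1+K : ∀ {p} → w p ≡ suc K → prepend K w (fsuc p) ≡ suc (suc K)
  prepend-old-1+K wp≡1+K = trans (cong (punchInℕ K) wp≡1+K) (punchInℕ-≥ K (suc K) (ℕ.n≤1+n K))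

  -- thresholds up to K + 1 see only the old entries below K, which are untouched by the punch-in
  ¬forbiddenBelow-prepend-≤ : ¬ ForbiddenBelow w K → ∀ t → t ≤ suc K → ¬ ForbiddenBelow (prepend K w) t
  ¬forbiddenBelow-prepend-≤ ¬fb t t≤1+K (fzero , fsuc l , fsuc m , _ , _ , K<wm , wm<t , _) =
    ℕ.<-irrefl refl (ℕ.<-≤-trans K<wm (ℕ.≤-pred (ℕ.<-≤-trans wm<t t≤1+K)))
  ¬forbiddenBelow-prepend-≤ ¬fb t t≤1+K (fsuc j , fsuc l , fsuc m , s≤s j<l , s≤s l<m , wj<wm , wm<t , wl<t) =
    ¬fb (j , l , m , j<l , l<m , punchInℕ-cancel K wj<wm ,
         punchInℕ-<-suc K _ K ℕ.≤-refl (ℕ.<-≤-trans wm<t t≤1+K) ,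
         punchInℕ-<-suc K _ K ℕ.≤-refl (ℕ.<-≤-trans wl<t t≤1+K))

  leftToRightMin-prepend-self : LeftToRightMin (prepend K w) K
  leftToRightMin-prepend-self = fzero , refl , λ q ()

  leftToRightMin-prepend-below⁻ : ∀ x → x < K → LeftToRightMin (prepend K w) x → LeftToRightMin w x
  leftToRightMin-prepend-below⁻ x x<K (fzero , K≡x , _) = ⊥-elim (ℕ.<-irrefl (sym K≡x) x<K)
  leftToRightMin-prepend-below⁻ x x<K (fsuc p , wp≡x , min) =
    p , trans (sym (punchInℕ-< K _ wp<K)) wp≡x , earlier-larger
    where
    wp<K : w p < K
    wp<K = punchInℕ-<-reflect K _ (subst (_< K) (sym wp≡x) x<K)
    earlier-larger : ∀ q → q <ᶠ p → x < w q
    earlier-larger q q<p with ℕ.<-cmp (w q) K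
    ... | tri< wq<K _ _ = subst (x <_) (punchInℕ-< K _ wq<K) (min (fsuc q) (s≤s q<p))
    ... | tri≈ _ wq≡K _ = subst (x <_) (sym wq≡K) x<K
    ... | tri> _ _ K<wq = ℕ.<-trans x<K K<wq

  leftToRightMin-prepend-below⁺ : ∀ x → x < K → LeftToRightMin w x → LeftToRightMin (prepend K w) x
  leftToRightMin-prepend-below⁺ x x<K (p , wp≡x , min) =
    fsuc p , trans (punchInℕ-< K _ (subst (_< K) (sym wp≡x) x<K)) wp≡x , earlier-larger
    where
    earlier-larger : ∀ q → q <ᶠ fsuc p → x < prepend K w q
    earlier-larger fzero    _         = x<K
    earlier-larger (fsuc q) (s≤s q<p) = ℕ.<-≤-trans (min q q<p) (punchInℕ-inflationary K (w q))

  ¬leftToRightMin-prepend-above : ∀ x → K < x → ¬ LeftToRightMin (prepend K w) x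
  ¬leftToRightMin-prepend-above x K<x (fzero , K≡x , _)     = ℕ.<-irrefl K≡x K<x
  ¬leftToRightMin-prepend-above x K<x (fsuc p , _ , min)    = ℕ.<-asym K<x (min fzero (s≤s z≤n))

  module _ (inj : Injective w) where

    -- a triple blocking K + 2 but not K + 1 ends at the old K and has a smaller entry before it
    ¬forbiddenBelow-prepend-2+K : ¬ ForbiddenBelow w (suc K) → LeftToRightMin w K →
                                  ¬ ForbiddenBelow (prepend K w) (suc (suc K))
    ¬forbiddenBelow-prepend-2+K ¬fb (p , wp≡K , min) (fzero , fsuc l , fsuc m , _ , s≤s l<m , K<wm , wm<2+K , wl<2+K) =
      ℕ.<-asym wl<K (min l (subst (l <ᶠ_) (sym p≡m) l<m))
      where
      wm≡K : w m ≡ K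
      wm≡K = punchInℕ-injective K (trans (ℕ.≤-antisym (ℕ.≤-pred wm<2+K) K<wm) (sym (punchInℕ-self K)))
      p≡m : p ≡ m
      p≡m = inj p m (trans wp≡K (sym wm≡K))
      wl≢1+K : punchInℕ K (w l) ≢ suc K
      wl≢1+K eq = ℕ.<-irrefl (cong toℕ (inj l m wl≡wm)) l<m
        where
        wl≡wm : w l ≡ w m
        wl≡wm = trans (punchInℕ-injective K (trans eq (sym (punchInℕ-self K)))) (sym wm≡K)
      wl<K : w l < K
      wl<K = punchInℕ-<-suc K (w l) K ℕ.≤-refl (ℕ.≤∧≢⇒< (ℕ.≤-pred wl<2+K) wl≢1+K)
    ¬forbiddenBelow-prepend-2+K ¬fb _ (fsuc j , fsuc l , fsuc m , s≤s j<l , s≤s l<m , wj<wm , wm<2+K , wl<2+K) =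
      ¬fb (j , l , m , j<l , l<m , punchInℕ-cancel K wj<wm ,
           punchInℕ-<-suc K _ (suc K) (ℕ.n≤1+n K) wm<2+K , punchInℕ-<-suc K _ (suc K) (ℕ.n≤1+n K) wl<2+K)

    module _ (onto : Onto w) where

      leftToRightMin-of-¬forbiddenBelow : K < n → ¬ ForbiddenBelow (prepend K w) (suc (suc K)) → LeftToRightMin w K
      leftToRightMin-of-¬forbiddenBelow K<n ¬fb with onto K K<n
      ... | p , wp≡K = p , wp≡K , earlier-larger
        where
        earlier-larger : ∀ q → q <ᶠ p → K < w q
        earlier-larger q q<p with ℕ.<-cmp (w q) K
        ... | tri< wq<K _ _ = ⊥-elim (¬fb (fzero , fsuc q , fsuc p , s≤s z≤n , s≤s q<p ,
                subst (K <_) (sym (prepend-old-K wp≡K)) (ℕ.n<1+n K) ,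
                subst (_< suc (suc K)) (sym (prepend-old-K wp≡K)) (ℕ.n<1+n (suc K)) ,
                subst (_< suc (suc K)) (sym (punchInℕ-< K _ wq<K)) (ℕ.<-trans wq<K (ℕ.m<n⇒m<1+n (ℕ.n<1+n K)))))
        ... | tri≈ _ wq≡K _ = ⊥-elim (ℕ.<-irrefl (cong toℕ (inj q p (trans wq≡K (sym wp≡K)))) q<p)
        ... | tri> _ _ K<wq = K<wq

  -- the old K, K + 1 become K + 1, K + 2 and, after the new first entry K, block every t > K + 2
  forbiddenBelow-prepend-> : Onto w → suc K < n → ∀ t → suc (suc K) < t → ForbiddenBelow (prepend K w) t
  forbiddenBelow-prepend-> onto 1+K<n t 2+K<t with onto K (ℕ.<-trans (ℕ.n<1+n K) 1+K<n) | onto (suc K) 1+K<n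
  ... | p , wp≡K | q , wq≡1+K with Fin.<-cmp p q
  ... | tri< p<q _ _ = fzero , fsuc p , fsuc q , s≤s z≤n , s≤s p<q ,
                       subst (K <_) (sym (prepend-old-1+K wq≡1+K)) (ℕ.m<n⇒m<1+n (ℕ.n<1+n K)) ,
                       subst (_< t) (sym (prepend-old-1+K wq≡1+K)) 2+K<t ,
                       subst (_< t) (sym (prepend-old-K wp≡K)) (ℕ.<-trans (ℕ.n<1+n (suc K)) 2+K<t)
  ... | tri≈ _ p≡q _ = ⊥-elim (ℕ.<-irrefl (trans (sym wp≡K) (trans (cong w p≡q) wq≡1+K)) (ℕ.n<1+n K))
  ... | tri> _ _ q<p = fzero , fsuc q , fsuc p , s≤s z≤n , s≤s q<p ,
                       subst (K <_) (sym (prepend-old-K wp≡K)) (ℕ.n<1+n K) ,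
                       subst (_< t) (sym (prepend-old-K wp≡K)) (ℕ.<-trans (ℕ.n<1+n (suc K)) 2+K<t) ,
                       subst (_< t) (sym (prepend-old-1+K wq≡1+K)) 2+K<t

module _ {n} {w w′ : Word n} (w≗w′ : ∀ p → w p ≡ w′ p) where

  forbidden-resp : Forbidden w → Forbidden w′
  forbidden-resp (i , j , l , m , i<j , j<l , l<m , wj<wm , wm<wi , wl<wi) =
    i , j , l , m , i<j , j<l , l<m ,
    subst₂ _<_ (w≗w′ j) (w≗w′ m) wj<wm ,
    subst₂ _<_ (w≗w′ m) (w≗w′ i) wm<wi ,
    subst₂ _<_ (w≗w′ l) (w≗w′ i) wl<wi

  forbiddenBelow-resp : ∀ {t} → ForbiddenBelow w t → ForbiddenBelow w′ t
  forbiddenBelow-resp (j , l , m , j<l , l<m , wj<wm , wm<t , wl<t) =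
    j , l , m , j<l , l<m ,
    subst₂ _<_ (w≗w′ j) (w≗w′ m) wj<wm , subst (_< _) (w≗w′ m) wm<t , subst (_< _) (w≗w′ l) wl<t

  leftToRightMin-resp : ∀ {x} → LeftToRightMin w x → LeftToRightMin w′ x
  leftToRightMin-resp (p , wp≡x , min) =
    p , trans (sym (w≗w′ p)) wp≡x , λ q q<p → subst (_ <_) (w≗w′ q) (min q q<p)

Marks : ∀ {n} → Word n → List Bool → Set
Marks w []      = ⊤
Marks w (y ∷ r) = (y ≡ true ⇔ LeftToRightMin w (length r)) × Marks w r

marks-transfer : ∀ {n n′} {w : Word n} {w′ : Word n′} L →
  (∀ x → x < length L → LeftToRightMin w x ⇔ LeftToRightMin w′ x) → Marks w L → Marks w′ L
marks-transfer []      _   _         = tt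
marks-transfer (y ∷ r) w⇔w′ (y⇔ , ms) =
  mk⇔ (Equivalence.to (w⇔w′ (length r) (ℕ.n<1+n _)) ∘′ Equivalence.to y⇔)
      (Equivalence.from y⇔ ∘′ Equivalence.from (w⇔w′ (length r) (ℕ.n<1+n _))) ,
  marks-transfer r (λ x x<r → w⇔w′ x (ℕ.m<n⇒m<1+n x<r)) ms


-- the admissible first entries for w are the values up to length L, and the bits of L record which
-- values below length L are left-to-right minima of w
record Labelled {n} (w : Word n) (L : List Bool) : Set where
  field
    length≤n     : length L ≤ n
    admissible-≤ : ∀ t → t ≤ n → ¬ ForbiddenBelow w t → t ≤ length L
    admissible   : ¬ ForbiddenBelow w (length L)
    marks        : Marks w L
    top-¬min     : ¬ LeftToRightMin w (length L)

labelled-empty : (w : Word 0) → Labelled w []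
labelled-empty w = record
  { length≤n = z≤n ; admissible-≤ = λ t t≤0 _ → t≤0 ; admissible = λ { (() , _) }
  ; marks = tt ; top-¬min = λ { (() , _) } }

lowerValue : (L : List Bool) → Fin (length L) → ℕ
lowerValue (y ∷ r) fzero    = length r
lowerValue (y ∷ r) (fsuc i) = lowerValue r i

value : (L : List Bool) → Fin (suc (length L)) → ℕ
value L fzero    = length L
value L (fsuc i) = lowerValue L i

-- choices are numbered downwards from the top value
lowerValue≡opposite : ∀ L (i : Fin (length L)) → lowerValue L i ≡ toℕ (opposite i)
lowerValue≡opposite (y ∷ r) fzero    = sym (Fin.toℕ-fromℕ (length r))
lowerValue≡opposite (y ∷ r) (fsuc i) = trans (lowerValue≡opposite r i) (sym (Fin.opposite-suc i))

value≡opposite : ∀ L (i : Fin (suc (length L))) → value L i ≡ toℕ (opposite i)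
value≡opposite L fzero    = sym (Fin.toℕ-fromℕ (length L))
value≡opposite L (fsuc i) = trans (lowerValue≡opposite L i) (sym (Fin.opposite-suc i))

value≤length : ∀ L i → value L i ≤ length L
value≤length L i = subst (_≤ length L) (sym (value≡opposite L i)) (ℕ.≤-pred (Fin.toℕ<n (opposite i)))

value-injective : ∀ L {i j} → value L i ≡ value L j → i ≡ j
value-injective L {i} {j} eq = begin
  i                       ≡⟨ Fin.opposite-involutive i ⟨
  opposite (opposite i)   ≡⟨ cong opposite (Fin.toℕ-injective opposites) ⟩
  opposite (opposite j)   ≡⟨ Fin.opposite-involutive j ⟩
  j                       ∎
  where
  open ≡-Reasoning
  opposites : toℕ (opposite i) ≡ toℕ (opposite j)
  opposites = trans (sym (value≡opposite L i)) (trans eq (value≡opposite L j))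

choiceFor : ∀ (L : List Bool) K → K ≤ length L → Fin (suc (length L))
choiceFor L K K≤L = opposite (fromℕ< {K} (s≤s K≤L))

value-choiceFor : ∀ L K (K≤L : K ≤ length L) → value L (choiceFor L K K≤L) ≡ K
value-choiceFor L K K≤L = begin
  value L (choiceFor L K K≤L)              ≡⟨ value≡opposite L (choiceFor L K K≤L) ⟩
  toℕ (opposite (opposite (fromℕ< {K} K<1+L)))  ≡⟨ cong toℕ (Fin.opposite-involutive (fromℕ< {K} K<1+L)) ⟩
  toℕ (fromℕ< {K} K<1+L)                        ≡⟨ Fin.toℕ-fromℕ< {K} K<1+L ⟩
  K                                         ∎
  where
  open ≡-Reasoning
  K<1+L : K < suc (length L)
  K<1+L = s≤s K≤L

choiceFor-value : ∀ L i (K≤L : value L i ≤ length L) → choiceFor L (value L i) K≤L ≡ i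
choiceFor-value L i K≤L = value-injective L {choiceFor L (value L i) K≤L} {i} (value-choiceFor L (value L i) K≤L)

module _ {n} {w : Word n} (inj : Injective w) (onto : Onto w) where

  private
    module P (K : ℕ) where
      w′ : Word (suc n)
      w′ = prepend K w

      admissible-≤2+K : ∀ t → t ≤ suc n → ¬ ForbiddenBelow w′ t → t ≤ suc (suc K)
      admissible-≤2+K t t≤1+n ¬fb with ℕ.≤-<-connex t (suc (suc K))
      ... | inj₁ t≤2+K = t≤2+K
      ... | inj₂ 2+K<t =
        ⊥-elim (¬fb (forbiddenBelow-prepend-> K w onto (ℕ.≤-pred (ℕ.<-≤-trans 2+K<t t≤1+n)) t 2+K<t))

      admissible-2+K⇒min : suc K ≤ n → ¬ ForbiddenBelow w′ (suc (suc K)) → LeftToRightMin w K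
      admissible-2+K⇒min = leftToRightMin-of-¬forbiddenBelow K w inj onto

      marks-below : ∀ L → length L ≤ K → Marks w L → Marks w′ L
      marks-below L L≤K = marks-transfer L λ x x<L →
        mk⇔ (leftToRightMin-prepend-below⁺ K w x (ℕ.<-≤-trans x<L L≤K))
            (leftToRightMin-prepend-below⁻ K w x (ℕ.<-≤-trans x<L L≤K))

  labelled-top : ∀ {L} → Labelled w L → Labelled (prepend (length L) w) (true ∷ L)
  labelled-top {L} ℓ = record
    { length≤n     = s≤s length≤n
    ; admissible-≤ = admissible-≤′
    ; admissible   = ¬forbiddenBelow-prepend-≤ K w admissible (suc K) ℕ.≤-refl
    ; marks        = mk⇔ (λ _ → leftToRightMin-prepend-self K w) (λ _ → refl) , marks-below L ℕ.≤-refl marks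
    ; top-¬min     = ¬leftToRightMin-prepend-above K w (suc K) (ℕ.n<1+n K)
    }
    where
    open Labelled ℓ
    K = length L
    open P K
    admissible-≤′ : ∀ t → t ≤ suc n → ¬ ForbiddenBelow w′ t → t ≤ suc K
    admissible-≤′ t t≤1+n ¬fb = ℕ.≤-pred (ℕ.≤∧≢⇒< (admissible-≤2+K t t≤1+n ¬fb) t≢2+K)
      where
      t≢2+K : t ≢ suc (suc K)
      t≢2+K refl = top-¬min (admissible-2+K⇒min (ℕ.≤-pred t≤1+n) ¬fb)

  labelled-childAt : ∀ y r → (y ≡ true ⇔ LeftToRightMin w (length r)) → Marks w r →
    ¬ ForbiddenBelow w (suc (length r)) → suc (length r) ≤ n → Labelled (prepend (length r) w) (childAt y r)
  labelled-childAt true r y⇔min ms ¬fb 1+K≤n = record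
    { length≤n     = s≤s 1+K≤n
    ; admissible-≤ = admissible-≤2+K
    ; admissible   = ¬forbiddenBelow-prepend-2+K K w inj ¬fb (Equivalence.to y⇔min refl)
    ; marks        = mk⇔ (λ ()) (⊥-elim ∘′ ¬leftToRightMin-prepend-above K w (suc K) (ℕ.n<1+n K)) ,
                     mk⇔ (λ _ → leftToRightMin-prepend-self K w) (λ _ → refl) ,
                     marks-below r ℕ.≤-refl ms
    ; top-¬min     = ¬leftToRightMin-prepend-above K w (suc (suc K)) (ℕ.m<n⇒m<1+n (ℕ.n<1+n K))
    }
    where
    K = length r
    open P K
  labelled-childAt false r y⇔min ms ¬fb 1+K≤n = record
    { length≤n     = s≤s (ℕ.<⇒≤ 1+K≤n)
    ; admissible-≤ = admissible-≤′
    ; admissible   = ¬forbiddenBelow-prepend-≤ K w (¬fb ∘′ forbiddenBelow-mono w (ℕ.n≤1+n K))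
                                                (suc K) ℕ.≤-refl
    ; marks        = mk⇔ (λ _ → leftToRightMin-prepend-self K w) (λ _ → refl) , marks-below r ℕ.≤-refl ms
    ; top-¬min     = ¬leftToRightMin-prepend-above K w (suc K) (ℕ.n<1+n K)
    }
    where
    K = length r
    open P K
    admissible-≤′ : ∀ t → t ≤ suc n → ¬ ForbiddenBelow w′ t → t ≤ suc K
    admissible-≤′ t t≤1+n ¬fb′ = ℕ.≤-pred (ℕ.≤∧≢⇒< (admissible-≤2+K t t≤1+n ¬fb′) t≢2+K)
      where
      t≢2+K : t ≢ suc (suc K)
      t≢2+K refl with Equivalence.from y⇔min (admissible-2+K⇒min 1+K≤n ¬fb′)
      ... | ()

  labelled-lower : ∀ L (i : Fin (length L)) → Marks w L → ¬ ForbiddenBelow w (length L) → length L ≤ n →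
    Labelled (prepend (lowerValue L i) w) (lowerChild L i)
  labelled-lower (y ∷ r) fzero    (y⇔min , ms) ¬fb L≤n = labelled-childAt y r y⇔min ms ¬fb L≤n
  labelled-lower (y ∷ r) (fsuc i) (_ , ms)     ¬fb L≤n =
    labelled-lower r i ms (¬fb ∘′ forbiddenBelow-mono w (ℕ.n≤1+n _)) (ℕ.≤-trans (ℕ.n≤1+n _) L≤n)

  labelled-child : ∀ {L} → Labelled w L → (i : Fin (suc (length L))) → Labelled (prepend (value L i) w) (child L i)
  labelled-child ℓ fzero    = labelled-top ℓ
  labelled-child ℓ (fsuc i) = labelled-lower _ i marks admissible length≤n
    where open Labelled ℓ

labelled-resp : ∀ {n} {w w′ : Word n} {L} → (∀ p → w p ≡ w′ p) → Labelled w L → Labelled w′ L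
labelled-resp {w = w} {w′} {L} w≗w′ ℓ = record
  { length≤n     = length≤n
  ; admissible-≤ = λ t t≤n ¬fb → admissible-≤ t t≤n (¬fb ∘′ forbiddenBelow-resp w≗w′)
  ; admissible   = admissible ∘′ forbiddenBelow-resp w′≗w
  ; marks        = marks-transfer L (λ _ _ → mk⇔ (leftToRightMin-resp w≗w′) (leftToRightMin-resp w′≗w)) marks
  ; top-¬min     = top-¬min ∘′ leftToRightMin-resp w′≗w
  }
  where
  open Labelled ℓ
  w′≗w : ∀ p → w′ p ≡ w p
  w′≗w p = sym (w≗w′ p)

word : ∀ {n} → Vec (Fin n) n → Word n
word v p = toℕ (lookup v p)

word-injective : ∀ {n} (v : Vec (Fin n) n) → IsPerm v → Injective (word v)
word-injective v perm p q eq = perm p q (Fin.toℕ-injective eq)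

-- a value missed by v would give an injection Fin n → Fin (n - 1)
word-onto : ∀ {n} (v : Vec (Fin n) n) → IsPerm v → Onto (word v)
word-onto {zero}  v perm x ()
word-onto {suc n} v perm x x<n with Fin.any? (λ p → lookup v p Fin.≟ fromℕ< x<n)
... | yes (p , vp≡x) = p , trans (cong toℕ vp≡x) (Fin.toℕ-fromℕ< x<n)
... | no missed      = ⊥-elim (ℕ.<-irrefl refl (Fin.injective⇒≤ squeeze-injective))
  where
  squeeze : Fin (suc n) → Fin n
  squeeze p = punchOut {i = fromℕ< x<n} (λ x≡vp → missed (p , sym x≡vp))
  squeeze-injective : ∀ {p q} → squeeze p ≡ squeeze q → p ≡ q
  squeeze-injective {p} {q} eq = perm p q (Fin.punchOut-injective {i = fromℕ< x<n} _ _ eq)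

increasing-by-steps : ∀ {k} (h : Fin (suc k) → ℕ) → (∀ i → h (inject₁ i) < h (fsuc i)) →
                      ∀ {i j} → i <ᶠ j → h i < h j
increasing-by-steps h step {fzero}  {fsuc fzero}     _ = step fzero
increasing-by-steps {suc k} h step {fzero}  {fsuc (fsuc j)} _ =
  ℕ.<-trans (step fzero)
            (increasing-by-steps (λ i → h (fsuc i)) (λ i → step (fsuc i)) {fzero} {fsuc j} (s≤s z≤n))
increasing-by-steps {suc k} h step {fsuc i} {fsuc j} (s≤s i<j) =
  increasing-by-steps (λ i → h (fsuc i)) (λ i → step (fsuc i)) i<j

module _ {n} (v : Vec (Fin n) n) where

  -- σ⁻¹ lists the positions of σ in order of value, so the steps say that v ∘ f is sorted like σ
  contains-by-steps : ∀ {k} (σ : Vec (Fin (suc k)) (suc k)) (σ⁻¹ : Fin (suc k) → Fin (suc k)) →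
    (∀ a → σ⁻¹ (lookup σ a) ≡ a) →
    (f : Fin (suc k) → Fin n) → (∀ i → f (inject₁ i) <ᶠ f (fsuc i)) →
    (∀ i → word v (f (σ⁻¹ (inject₁ i))) < word v (f (σ⁻¹ (fsuc i)))) → Contains v σ
  contains-by-steps σ σ⁻¹ inverse f f-steps g-steps =
    f , (λ a b → increasing-by-steps (toℕ ∘ f) f-steps) , λ a b → mk⇔ (forward a b) (backward a b)
    where
    g : Fin _ → ℕ
    g = word v ∘ f
    forward : ∀ a b → lookup σ a <ᶠ lookup σ b → g a < g b
    forward a b σa<σb =
      subst₂ (λ a′ b′ → g a′ < g b′) (inverse a) (inverse b)
             (increasing-by-steps (g ∘ σ⁻¹) g-steps σa<σb)
    backward : ∀ a b → g a < g b → lookup σ a <ᶠ lookup σ b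
    backward a b ga<gb with Fin.<-cmp (lookup σ a) (lookup σ b)
    ... | tri< σa<σb _ _ = σa<σb
    ... | tri≈ _ σa≡σb _ = ⊥-elim (ℕ.<-irrefl (cong g a≡b) ga<gb)
      where
      a≡b : a ≡ b
      a≡b = trans (sym (inverse a)) (trans (cong σ⁻¹ σa≡σb) (inverse b))
    ... | tri> _ _ σb<σa = ⊥-elim (ℕ.<-asym ga<gb (forward b a σb<σa))

  contains⇒forbidden : (σ : Vec (Fin 4) 4) →
    lookup σ (# 1) <ᶠ lookup σ (# 3) → lookup σ (# 3) <ᶠ lookup σ (# 0) →
    lookup σ (# 2) <ᶠ lookup σ (# 0) → Contains v σ → Forbidden (word v)
  contains⇒forbidden σ σ₁<σ₃ σ₃<σ₀ σ₂<σ₀ (f , increasing , order) =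
    f (# 0) , f (# 1) , f (# 2) , f (# 3) ,
    increasing _ _ (s≤s z≤n) , increasing _ _ (s≤s (s≤s z≤n)) , increasing _ _ (s≤s (s≤s (s≤s z≤n))) ,
    Equivalence.to (order _ _) σ₁<σ₃ , Equivalence.to (order _ _) σ₃<σ₀ , Equivalence.to (order _ _) σ₂<σ₀

  contains-at : ∀ {i j l m} → i <ᶠ j → j <ᶠ l → l <ᶠ m → (σ σ⁻¹ : Vec (Fin 4) 4) →
    {True (Fin.all? λ a → lookup σ⁻¹ (lookup σ a) Fin.≟ a)} →
    let g = λ a → word v (lookup (i ∷ j ∷ l ∷ m ∷ []) (lookup σ⁻¹ a)) in
    g (# 0) < g (# 1) → g (# 1) < g (# 2) → g (# 2) < g (# 3) → Contains v σ
  contains-at {i} {j} {l} {m} i<j j<l l<m σ σ⁻¹ {inverse} g₀<g₁ g₁<g₂ g₂<g₃ =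
    contains-by-steps σ (lookup σ⁻¹) (toWitness inverse) (lookup (i ∷ j ∷ l ∷ m ∷ []))
      (λ { fzero → i<j ; (fsuc fzero) → j<l ; (fsuc (fsuc fzero)) → l<m })
      (λ { fzero → g₀<g₁ ; (fsuc fzero) → g₁<g₂ ; (fsuc (fsuc fzero)) → g₂<g₃ })

  forbidden⇒contains : IsPerm v → Forbidden (word v) → Contains v p4123 ⊎ Contains v p4132 ⊎ Contains v p4213
  forbidden⇒contains perm (i , j , l , m , i<j , j<l , l<m , wj<wm , wm<wi , wl<wi)
    with ℕ.<-cmp (word v l) (word v j) | ℕ.<-cmp (word v l) (word v m)
  ... | tri< wl<wj _ _ | _ =
    inj₂ (inj₂ (contains-at i<j j<l l<m p4213 (# 2 ∷ # 1 ∷ # 3 ∷ # 0 ∷ []) wl<wj wj<wm wm<wi))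
  ... | tri≈ _ wl≡wj _ | _ = ⊥-elim (ℕ.<-irrefl (cong toℕ (word-injective v perm j l (sym wl≡wj))) j<l)
  ... | tri> _ _ _ | tri≈ _ wl≡wm _ = ⊥-elim (ℕ.<-irrefl (cong toℕ (word-injective v perm l m wl≡wm)) l<m)
  ... | tri> _ _ wj<wl | tri< wl<wm _ _ =
    inj₁ (contains-at i<j j<l l<m p4123 (# 1 ∷ # 2 ∷ # 3 ∷ # 0 ∷ []) wj<wl wl<wm wm<wi)
  ... | tri> _ _ _ | tri> _ _ wm<wl =
    inj₂ (inj₁ (contains-at i<j j<l l<m p4132 (# 1 ∷ # 3 ∷ # 2 ∷ # 0 ∷ []) wj<wm wm<wl wl<wi))

lookup-extensional : ∀ {A : Set} {n} {u v : Vec A n} → (∀ p → lookup u p ≡ lookup v p) → u ≡ v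
lookup-extensional {u = u} {v} same =
  trans (sym (Vecₚ.tabulate∘lookup u)) (trans (Vecₚ.tabulate-cong same) (Vecₚ.tabulate∘lookup v))

prependVec : ∀ {n} → Fin (suc n) → Vec (Fin n) n → Vec (Fin (suc n)) (suc n)
prependVec k v = k ∷ map (punchIn k) v

toℕ-punchIn : ∀ {n} (k : Fin (suc n)) (x : Fin n) → toℕ (punchIn k x) ≡ punchInℕ (toℕ k) (toℕ x)
toℕ-punchIn fzero    x        = refl
toℕ-punchIn (fsuc k) fzero    = refl
toℕ-punchIn (fsuc k) (fsuc x) = cong suc (toℕ-punchIn k x)

word-prependVec : ∀ {n} (k : Fin (suc n)) (v : Vec (Fin n) n) p →
                  word (prependVec k v) p ≡ prepend (toℕ k) (word v) p
word-prependVec k v fzero    = refl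
word-prependVec k v (fsuc p) = trans (cong toℕ (Vecₚ.lookup-map p (punchIn k) v)) (toℕ-punchIn k (lookup v p))

isPerm-prependVec : ∀ {n} (k : Fin (suc n)) {v : Vec (Fin n) n} → IsPerm v → IsPerm (prependVec k v)
isPerm-prependVec k     perm fzero    fzero    _  = refl
isPerm-prependVec k {v} perm fzero    (fsuc q) eq =
  ⊥-elim (Fin.punchInᵢ≢i k (lookup v q) (sym (trans eq (Vecₚ.lookup-map q (punchIn k) v))))
isPerm-prependVec k {v} perm (fsuc p) fzero    eq =
  ⊥-elim (Fin.punchInᵢ≢i k (lookup v p) (trans (sym (Vecₚ.lookup-map p (punchIn k) v)) eq))
isPerm-prependVec k {v} perm (fsuc p) (fsuc q) eq = cong fsuc (perm p q (Fin.punchIn-injective k _ _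
  (trans (sym (Vecₚ.lookup-map p (punchIn k) v)) (trans eq (Vecₚ.lookup-map q (punchIn k) v)))))

module _ {n} (v : Vec (Fin (suc n)) (suc n)) (perm : IsPerm v) where

  head≢ : ∀ p → lookup v fzero ≢ lookup v (fsuc p)
  head≢ p eq with perm fzero (fsuc p) eq
  ... | ()

  -- the standardisation of the entries after the first
  tailVec : Vec (Fin n) n
  tailVec = tabulate λ p → punchOut (head≢ p)

  isPerm-tailVec : IsPerm tailVec
  isPerm-tailVec p q eq = Fin.suc-injective (perm (fsuc p) (fsuc q) (Fin.punchOut-injective (head≢ p) (head≢ q)
    (trans (sym (Vecₚ.lookup∘tabulate _ p)) (trans eq (Vecₚ.lookup∘tabulate _ q)))))

  prependVec-head-tailVec : prependVec (lookup v fzero) tailVec ≡ v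
  prependVec-head-tailVec = lookup-extensional same
    where
    same : ∀ p → lookup (prependVec (lookup v fzero) tailVec) p ≡ lookup v p
    same fzero    = refl
    same (fsuc p) = trans (Vecₚ.lookup-map p (punchIn (lookup v fzero)) tailVec)
      (trans (cong (punchIn (lookup v fzero)) (Vecₚ.lookup∘tabulate _ p)) (Fin.punchIn-punchOut (head≢ p)))

  word-decomposition : ∀ p → word v p ≡ prepend (toℕ (lookup v fzero)) (word tailVec) p
  word-decomposition p =
    trans (cong (λ u → word u p) (sym prependVec-head-tailVec)) (word-prependVec (lookup v fzero) tailVec p)

tailVec-prependVec : ∀ {n} (k : Fin (suc n)) (v : Vec (Fin n) n) (perm : IsPerm (prependVec k v)) →
                     tailVec (prependVec k v) perm ≡ v
tailVec-prependVec k v perm = trans (Vecₚ.tabulate-cong same) (Vecₚ.tabulate∘lookup v)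
  where
  same : ∀ p → punchOut (head≢ (prependVec k v) perm p) ≡ lookup v p
  same p = trans (Fin.punchOut-cong k (Vecₚ.lookup-map p (punchIn k) v)) (Fin.punchOut-punchIn k)

-- IsPerm has decidable conclusions, so the irrelevant field can be recovered
isPerm : ∀ {n} (π : Av n) → IsPerm (Av.perm π)
isPerm (mkAv v perm _ _ _) i j eq with i Fin.≟ j
... | yes i≡j = i≡j
... | no  i≢j = Irrelevant.⊥-elim (i≢j (perm i j eq))

¬forbidden : ∀ {n} (π : Av n) → ¬ Forbidden (word (Av.perm π))
¬forbidden π@(mkAv v _ a₁ a₂ a₃) occurrence =
  Irrelevant.⊥-elim (Sum.[ a₁ , Sum.[ a₂ , a₃ ] ] (forbidden⇒contains v (isPerm π) occurrence))

avoider : ∀ {n} (v : Vec (Fin n) n) → IsPerm v → ¬ Forbidden (word v) → Av n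
avoider v perm ¬forb = mkAv v perm
  (¬forb ∘′ contains⇒forbidden v p4123 (s≤s z≤n) (s≤s (s≤s (s≤s z≤n))) (s≤s (s≤s z≤n)))
  (¬forb ∘′ contains⇒forbidden v p4132 (s≤s z≤n) (s≤s (s≤s z≤n)) (s≤s (s≤s (s≤s z≤n))))
  (¬forb ∘′ contains⇒forbidden v p4213 (s≤s (s≤s z≤n)) (s≤s (s≤s (s≤s z≤n))) (s≤s z≤n))

Av-≡ : ∀ {n} {π π′ : Av n} → Av.perm π ≡ Av.perm π′ → π ≡ π′
Av-≡ {π = mkAv v _ _ _ _} {mkAv .v _ _ _ _} refl = refl

record Coding (n : ℕ) : Set where
  field
    encode        : Av n → Walk n []
    decode        : Walk n [] → Av n
    encode-decode : ∀ w → encode (decode w) ≡ w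
    decode-encode : ∀ π → decode (encode π) ≡ π
    labelled      : ∀ π → Labelled (word (Av.perm π)) (end n [] (encode π))

coding-zero : Coding 0
coding-zero = record
  { encode        = λ _ → tt
  ; decode        = λ _ → empty
  ; encode-decode = λ _ → refl
  ; decode-encode = λ { (mkAv [] _ _ _ _) → refl }
  ; labelled      = λ _ → labelled-empty _
  }
  where
  empty : Av 0
  empty = avoider [] (λ ()) (λ { (() , _) })

-- a permutation is coded by the walk of its tail, extended by the choice that gives its first entry
module Step {n} (c : Coding n) where
  open Coding c

  module Remove (π : Av (suc n)) where
    v    = Av.perm π
    perm = isPerm π
    K    = toℕ (lookup v fzero)
    v′   = tailVec v perm

    prepend≗word : ∀ p → prepend K (word v′) p ≡ word v p
    prepend≗word p = sym (word-decomposition v perm p)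

    ¬forbidden-prepend : ¬ (Forbidden (word v′) ⊎ ForbiddenBelow (word v′) K)
    ¬forbidden-prepend = ¬forbidden π ∘′ forbidden-resp prepend≗word ∘′ forbidden-prepend⁺ K (word v′)

    π′ : Av n
    π′ = avoider v′ (isPerm-tailVec v perm) (¬forbidden-prepend ∘′ inj₁)

    M : List Bool
    M = end n [] (encode π′)

    K≤M : K ≤ length M
    K≤M = Labelled.admissible-≤ (labelled π′) K (ℕ.≤-pred (Fin.toℕ<n (lookup v fzero)))
                                (¬forbidden-prepend ∘′ inj₂)

    choice : Fin (suc (length M))
    choice = choiceFor M K K≤M

    labelled-π : Labelled (word v) (child M choice)
    labelled-π = labelled-resp prepend≗word (subst (λ K → Labelled (prepend K (word v′)) (child M choice))
      (value-choiceFor M K K≤M)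
      (labelled-child (word-injective v′ (isPerm π′)) (word-onto v′ (isPerm π′)) (labelled π′) choice))

  module Insert (x : Extension n []) where
    w  = proj₁ x
    i  = proj₂ x
    π′ = decode w
    v′ = Av.perm π′
    M  = end n [] w

    labelled-π′ : Labelled (word v′) M
    labelled-π′ = subst (Labelled (word v′) ∘′ end n []) (encode-decode w) (labelled π′)

    K = value M i

    K≤n : K ≤ n
    K≤n = ℕ.≤-trans (value≤length M i) (Labelled.length≤n labelled-π′)

    k : Fin (suc n)
    k = fromℕ< {K} (s≤s K≤n)

    word≗prepend : ∀ p → word (prependVec k v′) p ≡ prepend K (word v′) p
    word≗prepend p =
      trans (word-prependVec k v′ p) (cong (λ K → prepend K (word v′) p) (Fin.toℕ-fromℕ< (s≤s K≤n)))

    ¬forbidden-π : ¬ Forbidden (word (prependVec k v′))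
    ¬forbidden-π occurrence with forbidden-prepend⁻ K (word v′) (forbidden-resp word≗prepend occurrence)
    ... | inj₁ occurrence′ = ¬forbidden π′ occurrence′
    ... | inj₂ below       =
      Labelled.admissible labelled-π′ (forbiddenBelow-mono (word v′) (value≤length M i) below)

    π : Av (suc n)
    π = avoider (prependVec k v′) (isPerm-prependVec k (isPerm π′)) ¬forbidden-π

  encode′ : Av (suc n) → Extension n []
  encode′ π = encode π′ , choice
    where open Remove π

  decode′ : Extension n [] → Av (suc n)
  decode′ = Insert.π

  decode′-encode′ : ∀ π → decode′ (encode′ π) ≡ π
  decode′-encode′ π = Av-≡ (trans (cong₂ prependVec k≡head (cong Av.perm (decode-encode π′)))
                                  (prependVec-head-tailVec v perm))
    where
    open Remove π
    k≡head : Insert.k (encode′ π) ≡ lookup v fzero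
    k≡head = Fin.toℕ-injective (trans (Fin.toℕ-fromℕ< _) (value-choiceFor M K K≤M))

  extension-≡ : ∀ {w w′ : Walk n []} {K K′} (K≤ : K ≤ length (end n [] w)) (K′≤ : K′ ≤ length (end n [] w′)) →
                w ≡ w′ → K ≡ K′ →
                _≡_ {A = Extension n []} (w , choiceFor (end n [] w) K K≤) (w′ , choiceFor (end n [] w′) K′ K′≤)
  extension-≡ {w} {K = K} K≤ K′≤ refl refl =
    cong (λ K≤ → w , choiceFor (end n [] w) K K≤) (ℕ.≤-irrelevant K≤ K′≤)

  encode′-decode′ : ∀ x → encode′ (decode′ x) ≡ x
  encode′-decode′ x@(w , i) =
    trans (extension-≡ (Remove.K≤M π) (value≤length (end n [] w) i) encode-π′ K≡value)
          (cong (w ,_) (choiceFor-value (end n [] w) i (value≤length (end n [] w) i)))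
    where
    open Insert x using (π; k)
    π′≡ : Remove.π′ π ≡ decode w
    π′≡ = Av-≡ (tailVec-prependVec k (Av.perm (decode w)) (isPerm π))
    encode-π′ : encode (Remove.π′ π) ≡ w
    encode-π′ = trans (cong encode π′≡) (encode-decode w)
    K≡value : Remove.K π ≡ value (end n [] w) i
    K≡value = Fin.toℕ-fromℕ< (s≤s (Insert.K≤n x))

  coding-suc : Coding (suc n)
  coding-suc = record
    { encode        = snoc n [] ∘′ encode′
    ; decode        = decode′ ∘′ unsnoc n []
    ; encode-decode = λ w → trans (cong (snoc n []) (encode′-decode′ (unsnoc n [] w))) (snoc-unsnoc n [] w)
    ; decode-encode = λ π → trans (cong decode′ (unsnoc-snoc n [] (encode′ π))) (decode′-encode′ π)
    ; labelled      = λ π → subst (Labelled (word (Av.perm π)))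
                                  (sym (end-snoc n [] (encode (Remove.π′ π)) (Remove.choice π)))
                                  (Remove.labelled-π π)
    }

coding : ∀ n → Coding n
coding zero    = coding-zero
coding (suc n) = Step.coding-suc (coding n)

Av↔count : ∀ n → Av n ↔ Fin (count n [])
Av↔count n = ↔-trans (mk↔ₛ′ encode decode encode-decode decode-encode) (Walk↔count n [])
  where open Coding (coding n)

mainTheorem6 : (a : ℕ → ℕ) → (∀ n → Av n ↔ Fin (a n)) →
               ∀ n → lhs (λ m → + a m) n ≡ + 0
mainTheorem6 a Av↔a n = begin
  lhs s n          ≡⟨ lhs≈-kernel s n ⟩
  - kernel s n     ≡⟨ cong -_ (Kernel.kernel-vanishes s s≡count n n ℕ.≤-refl) ⟩
  + 0              ∎
  where
  open ≡-Reasoning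
  s : Series
  s m = + a m
  s≡count : ∀ m → s m ≡ + count m []
  s≡count m = cong +_ (↔⇒≡ (↔-trans (↔-sym (Av↔a m)) (Av↔count m)))
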